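{- Let $G=(V,E)$ be a finite simple graph of order $n$ and let $T=n-1$. If $(s,x,y,z)$ is an optimal solution of the Infection Model $\mathrm{IM}(G,T)$, i.e. it minimizes $\sum_{v\in V}s_v$ subject to $s\in\{0,1\}^V$, $x\in\{0,\ldots,T\}^V$, $y\in\{0,1\}^A$, $z\in\{0,\ldots,T\}$ and (i) $s_v+\sum_{a=(u,v)\in A}y_a=1$ for all $v\in V$; (ii) $x_u-x_v+(T+1)y_a\le T$ for all $a=(u,v)\in A$; (iii) $x_w-x_v+(T+1)y_a\le T$ for all $a=(u,v)\in A$, $w\in N(u)\setminus\{v\}$; (iv) $x_v\le z$ for all $v\in V$, then $C=\{v\in V: s_v=1\}$ is a minimum zero forcing set of $G$.
   Context: $N(u)$ is the neighborhood of $u$; $A$ contains both arcs $(u,v)$ and $(v,u)$ for each edge $\{u,v\}\in E$. Standard zero forcing rule: a filled vertex $u$ forces a non-filled vertex $v$ if $v$ is the only non-filled neighbor of $u$. $C\subseteq V$ is a zero forcing set if, starting with $C$ filled and applying the rule repeatedly, all vertices become filled; a minimum zero forcing set is one of minimum cardinality (this cardinality is the zero forcing number $Z(G)$). -}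

module Defs where

open import Data.Nat using (ℕ; zero; suc; _+_; _*_; _∸_; _≤_)
open import Data.Bool using (Bool; true; false; if_then_else_)
open import Data.Fin using (Fin; zero; suc)
open import Data.Fin.Subset using (Subset; _∈_; _∉_; ⁅_⁆; _∪_; ∣_∣)
open import Data.Vec using (tabulate)
open import Data.Product using (Σ; _×_)
open import Relation.Binary.PropositionalEquality using (_≡_; _≢_)

record Graph (n : ℕ) : Set where
  field
    adj     : Fin n → Fin n → Bool
    adj-sym : ∀ u v → adj u v ≡ adj v u
    irrefl  : ∀ v → adj v v ≡ false
open Graph public

sumFin : ∀ {n} → (Fin n → ℕ) → ℕ
sumFin {zero}  f = 0
sumFin {suc n} f = f zero + sumFin (λ i → f (suc i))

module _ {n : ℕ} (G : Graph n) where

  -- Arc set A = {(u,v) : adj u v}.  y is given on all ordered pairs but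
  -- only its values on arcs enter the model.
  -- Feasibility for IM(G,T):
  record Feasible (T : ℕ) (s : Fin n → ℕ) (x : Fin n → ℕ)
                  (y : Fin n → Fin n → ℕ) (z : ℕ) : Set where
    field
      s-bin : ∀ v → s v ≤ 1
      x-rng : ∀ v → x v ≤ T
      y-bin : ∀ u v → adj G u v ≡ true → y u v ≤ 1
      z-rng : z ≤ T
      c-i   : ∀ v → s v + sumFin (λ u → if adj G u v then y u v else 0) ≡ 1
      -- (ii) x_u - x_v + (T+1) y_(u,v) ≤ T  (rearranged over ℕ)
      c-ii  : ∀ u v → adj G u v ≡ true → x u + suc T * y u v ≤ T + x v
      c-iii : ∀ u v w → adj G u v ≡ true → adj G u w ≡ true → w ≢ v →
              x w + suc T * y u v ≤ T + x v
      c-iv  : ∀ v → x v ≤ z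

  Optimal : (T : ℕ) (s : Fin n → ℕ) (x : Fin n → ℕ)
            (y : Fin n → Fin n → ℕ) (z : ℕ) → Set
  Optimal T s x y z =
    Feasible T s x y z ×
    (∀ s' x' y' z' → Feasible T s' x' y' z' → sumFin s ≤ sumFin s')

  data Reach (C : Subset n) : Subset n → Set where
    start : Reach C C
    force : ∀ {S} u v → Reach C S → u ∈ S → v ∉ S → adj G u v ≡ true →
            (∀ w → adj G u w ≡ true → w ≢ v → w ∈ S) →
            Reach C (S ∪ ⁅ v ⁆)

  IsZeroForcingSet : Subset n → Set
  IsZeroForcingSet C = Σ (Subset n) (λ S → Reach C S × (∀ v → v ∈ S))

  IsMinimumZeroForcingSet : Subset n → Set
  IsMinimumZeroForcingSet C =
    IsZeroForcingSet C × (∀ C' → IsZeroForcingSet C' → ∣ C ∣ ≤ ∣ C' ∣)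

supportOf : ∀ {n} → (Fin n → ℕ) → Subset n
supportOf s = tabulate (λ v → Data.Nat._≡ᵇ_ (s v) 1)

{-# OPTIONS --safe #-}
-- A feasible solution of IM(G,T) is an encoded forcing process: y picks for every vertex outside
-- C = {s = 1} the neighbour that forces it, and by (ii)-(iii) this forcer and its other neighbours
-- carry strictly smaller time stamps x. Filling the vertices level by level in the order of x is
-- therefore a forcing process from C, so C is zero forcing. Conversely, a forcing process from any
-- zero forcing set C', time-stamped by the number of vertices filled so far (at most n - 1), is a
-- feasible solution with objective |C'|; optimality gives |C| ≤ |C'|.
module Submission where

open import Defs
open import Data.Nat using (ℕ; zero; suc; pred; _+_; _*_; _∸_; _≤_; _<_; z≤n; s≤s; z<s; s≤s⁻¹; _≤?_; _≡ᵇ_; >-nonZero)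
open import Data.Nat.Properties
  using (≤-refl; ≤-reflexive; ≤-trans; <-≤-trans; ≤-<-trans; n≮0; <⇒≤pred; module ≤-Reasoning;
         +-comm; +-suc; +-identityʳ; *-zeroʳ; *-identityʳ; m≤m+n; m≤n+m; m≤m*n;
         +-monoˡ-≤; +-monoʳ-≤; +-cancelʳ-≤; pred[m∸n]≡m∸[1+n])
open import Data.Bool using (true; false; if_then_else_)
open import Data.Bool.Properties using (if-eta; if-cong-then)
open import Data.Fin using (Fin; zero; suc)
open import Data.Fin.Properties using (suc-injective) renaming (_≟_ to _≟ᶠ_)
open import Data.Fin.Subset using (Subset; _∈_; _∉_; _⊆_; ⁅_⁆; _∪_; ∣_∣)
open import Data.Fin.Subset.Properties
  using (_∈?_; ⊆-refl; ⊆-trans; p⊆p∪q; q⊆p∪q; x∈p∪q⁻; x∈⁅x⁆; x∈⁅y⁆⇒x≡y; ∣p∣≤n; p⊂q⇒∣p∣<∣q∣; x∈p⇒∣p-x∣<∣p∣)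
open import Data.Vec using ([]; _∷_; lookup)
open import Data.Vec.Properties using ([]=⇒lookup; lookup⇒[]=; lookup∘tabulate)
open import Data.Vec.Functional using (updateAt)
open import Data.Vec.Functional.Properties using (updateAt-updates; updateAt-minimal)
open import Data.List using (List; []; _∷_; allFin)
open import Data.List.Relation.Unary.Any using (here; there)
open import Data.List.Membership.Propositional using () renaming (_∈_ to _∈ˡ_)
open import Data.List.Membership.Propositional.Properties using (∈-allFin)
open import Data.Product using (∃-syntax; _×_; _,_)
open import Data.Sum using (inj₁; inj₂)
open import Function using (_∘_; const)
open import Relation.Nullary using (yes; no; contradiction)
open import Relation.Binary.PropositionalEquality
  using (_≡_; _≢_; refl; sym; trans; cong; cong₂; subst; subst₂; module ≡-Reasoning)

sumFin-cong : ∀ {n} {f g : Fin n → ℕ} → (∀ i → f i ≡ g i) → sumFin f ≡ sumFin g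
sumFin-cong {zero}  f≗g = refl
sumFin-cong {suc n} f≗g = cong₂ _+_ (f≗g zero) (sumFin-cong (f≗g ∘ suc))

sumFin-zero : ∀ {n} {f : Fin n → ℕ} → (∀ i → f i ≡ 0) → sumFin f ≡ 0
sumFin-zero {zero}  f≗0 = refl
sumFin-zero {suc n} f≗0 = cong₂ _+_ (f≗0 zero) (sumFin-zero (f≗0 ∘ suc))

sumFin-single : ∀ {n} {f : Fin n → ℕ} (j : Fin n) → (∀ i → i ≢ j → f i ≡ 0) → sumFin f ≡ f j
sumFin-single {f = f} zero    f≗0 =
  trans (cong (f zero +_) (sumFin-zero (λ i → f≗0 (suc i) λ ()))) (+-identityʳ (f zero))
sumFin-single         (suc j) f≗0 =
  cong₂ _+_ (f≗0 zero λ ()) (sumFin-single j (λ i i≢j → f≗0 (suc i) (i≢j ∘ suc-injective)))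

f≤sumFin : ∀ {n} (f : Fin n → ℕ) (i : Fin n) → f i ≤ sumFin f
f≤sumFin f zero    = m≤m+n (f zero) _
f≤sumFin f (suc i) = ≤-trans (f≤sumFin (f ∘ suc) i) (m≤n+m _ (f zero))

sumFin>0⇒∃>0 : ∀ {n} (f : Fin n → ℕ) → 0 < sumFin f → ∃[ i ] 0 < f i
sumFin>0⇒∃>0 {suc n} f sum>0 with f zero in eq
... | suc _ = zero , subst (0 <_) (sym eq) z<s
... | zero  = let i , fi>0 = sumFin>0⇒∃>0 (f ∘ suc) sum>0 in suc i , fi>0

indicator : ∀ {n} → Subset n → Fin n → ℕ
indicator p i = if lookup p i then 1 else 0

sumFin-indicator : ∀ {n} (p : Subset n) → sumFin (indicator p) ≡ ∣ p ∣
sumFin-indicator []          = refl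
sumFin-indicator (true  ∷ p) = cong suc (sumFin-indicator p)
sumFin-indicator (false ∷ p) = sumFin-indicator p

indicator≤1 : ∀ {n} (p : Subset n) i → indicator p i ≤ 1
indicator≤1 p i with lookup p i
... | true  = ≤-refl
... | false = z≤n

indicator-∈ : ∀ {n} {p : Subset n} {i} → i ∈ p → indicator p i ≡ 1
indicator-∈ i∈p rewrite []=⇒lookup i∈p = refl

indicator-∉ : ∀ {n} {p : Subset n} {i} → i ∉ p → indicator p i ≡ 0
indicator-∉ {p = p} {i} i∉p with lookup p i in eq
... | true  = contradiction (lookup⇒[]= i p eq) i∉p
... | false = refl

indicator≡1⇒∈ : ∀ {n} {p : Subset n} {i} → indicator p i ≡ 1 → i ∈ p
indicator≡1⇒∈ {p = p} {i} _ with lookup p i in eq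
... | true = lookup⇒[]= i p eq

indicator-supportOf : ∀ {n} (s : Fin n → ℕ) i → s i ≤ 1 → indicator (supportOf s) i ≡ s i
indicator-supportOf s i si≤1 rewrite lookup∘tabulate (λ v → s v ≡ᵇ 1) i with s i | si≤1
... | 0 | z≤n     = refl
... | 1 | s≤s z≤n = refl

∣supportOf∣≡sumFin : ∀ {n} (s : Fin n → ℕ) → (∀ i → s i ≤ 1) → ∣ supportOf s ∣ ≡ sumFin s
∣supportOf∣≡sumFin s s≤1 =
  trans (sym (sumFin-indicator (supportOf s))) (sumFin-cong (λ i → indicator-supportOf s i (s≤1 i)))

∉supportOf⇒≡0 : ∀ {n} (s : Fin n → ℕ) {i} → s i ≤ 1 → i ∉ supportOf s → s i ≡ 0
∉supportOf⇒≡0 s si≤1 i∉C = trans (sym (indicator-supportOf s _ si≤1)) (indicator-∉ i∉C)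

-- Constraints (ii) and (iii) are big-M constraints: with y = 1 they say a < b, with y = 0 they are void.
bigM⇒< : ∀ {a b c T} → 0 < c → a + suc T * c ≤ T + b → a < b
bigM⇒< {a} {b} {c} {T} c>0 bigM = +-cancelʳ-≤ T (suc a) b (begin
  suc a + T     ≡⟨ +-suc a T ⟨
  a + suc T     ≤⟨ +-monoʳ-≤ a (m≤m*n (suc T) c {{>-nonZero c>0}}) ⟩
  a + suc T * c ≤⟨ bigM ⟩
  T + b         ≡⟨ +-comm T b ⟩
  b + T         ∎)
  where open ≤-Reasoning

<⇒bigM : ∀ {a b c T} → c ≤ 1 → (c ≡ 1 → a < b) → a ≤ T → a + suc T * c ≤ T + b
<⇒bigM {a} {b} {T = T} z≤n _ a≤T = begin
  a + suc T * 0 ≡⟨ cong (a +_) (*-zeroʳ (suc T)) ⟩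
  a + 0         ≡⟨ +-identityʳ a ⟩
  a             ≤⟨ a≤T ⟩
  T             ≤⟨ m≤m+n T b ⟩
  T + b         ∎
  where open ≤-Reasoning
<⇒bigM {a} {b} {T = T} (s≤s z≤n) a<b _ = begin
  a + suc T * 1 ≡⟨ cong (a +_) (*-identityʳ (suc T)) ⟩
  a + suc T     ≡⟨ +-suc a T ⟩
  suc a + T     ≤⟨ +-monoˡ-≤ T (a<b refl) ⟩
  b + T         ≡⟨ +-comm b T ⟩
  T + b         ∎
  where open ≤-Reasoning

module _ {n : ℕ} (G : Graph n) where

  inflow : (Fin n → Fin n → ℕ) → Fin n → ℕ
  inflow y v = sumFin (λ u → if adj G u v then y u v else 0)

  Reach⇒⊇ : ∀ {C S} → Reach G C S → C ⊆ S
  Reach⇒⊇ start                 = ⊆-refl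
  Reach⇒⊇ (force _ v r _ _ _ _) = ⊆-trans (Reach⇒⊇ r) (p⊆p∪q ⁅ v ⁆)

  Forcer : (Fin n → ℕ) → Fin n → Set
  Forcer rank v = ∃[ u ] adj G u v ≡ true × rank u < rank v ×
                         (∀ w → adj G u w ≡ true → w ≢ v → rank w < rank v)

  module _ {C : Subset n} (rank : Fin n → ℕ) (forcer : ∀ v → v ∉ C → Forcer rank v) where

    fill-vertex : ∀ {S} v → Reach G C S → (∀ w → rank w < rank v → w ∈ S) →
                  ∃[ S′ ] Reach G C S′ × S ⊆ S′ × v ∈ S′
    fill-vertex {S} v r earlier with v ∈? S
    ... | yes v∈S = S , r , ⊆-refl , v∈S
    ... | no  v∉S with forcer v (v∉S ∘ Reach⇒⊇ r)
    ... | u , u~v , ru<rv , others<rv =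
      S ∪ ⁅ v ⁆ ,
      force u v r (earlier u ru<rv) v∉S u~v (λ w u~w w≢v → earlier w (others<rv w u~w w≢v)) ,
      p⊆p∪q ⁅ v ⁆ , q⊆p∪q S ⁅ v ⁆ (x∈⁅x⁆ v)

    fill-level : ∀ {S} k (L : List (Fin n)) → Reach G C S → (∀ w → rank w < k → w ∈ S) →
                 ∃[ S′ ] Reach G C S′ × S ⊆ S′ × (∀ v → v ∈ˡ L → rank v ≤ k → v ∈ S′)
    fill-level k []      r below = _ , r , ⊆-refl , λ _ ()
    fill-level k (v ∷ L) r below with rank v ≤? k
    ... | no rv≰k =
      let S′ , r′ , S⊆S′ , filled = fill-level k L r below
      in S′ , r′ , S⊆S′ , λ { _ (here refl) rv≤k → contradiction rv≤k rv≰k ; w (there w∈L) → filled w w∈L }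
    ... | yes rv≤k =
      let S₁ , r₁ , S⊆S₁ , v∈S₁  = fill-vertex v r (λ w rw<rv → below w (<-≤-trans rw<rv rv≤k))
          S₂ , r₂ , S₁⊆S₂ , filled = fill-level k L r₁ (λ w rw<k → S⊆S₁ (below w rw<k))
      in S₂ , r₂ , ⊆-trans S⊆S₁ S₁⊆S₂ , λ { _ (here refl) _ → S₁⊆S₂ v∈S₁ ; w (there w∈L) → filled w w∈L }

    fill-below : ∀ k → ∃[ S ] Reach G C S × (∀ v → rank v < k → v ∈ S)
    fill-below zero    = C , start , λ _ ()
    fill-below (suc k) =
      let S  , r  , below       = fill-below k
          S′ , r′ , _ , filled = fill-level k (allFin n) r below
      in S′ , r′ , λ v rv<1+k → filled v (∈-allFin v) (s≤s⁻¹ rv<1+k)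

    ranked⇒zeroForcing : IsZeroForcingSet G C
    ranked⇒zeroForcing =
      let S , r , below = fill-below (suc (sumFin rank))
      in S , r , λ v → below v (s≤s (f≤sumFin rank v))

  feasible⇒forcer : ∀ {T s x y z} → Feasible G T s x y z → ∀ v → v ∉ supportOf s → Forcer x v
  feasible⇒forcer {s = s} {x} {y} F v v∉C = forcer-of (sumFin>0⇒∃>0 _ inflow>0)
    where
    open Feasible F
    inflow>0 : 0 < inflow y v
    inflow>0 = ≤-reflexive (sym (subst (λ t → t + inflow y v ≡ 1) (∉supportOf⇒≡0 s (s-bin v) v∉C) (c-i v)))
    forcer-of : ∃[ u ] 0 < (if adj G u v then y u v else 0) → Forcer x v
    forcer-of (u , pos) with adj G u v in u~v
    ... | true  = u , u~v , bigM⇒< pos (c-ii u v u~v) ,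
                  λ w u~w w≢v → bigM⇒< pos (c-iii u v w u~v u~w w≢v)
    ... | false = contradiction pos n≮0

  feasible⇒zeroForcing : ∀ {T s x y z} → Feasible G T s x y z → IsZeroForcingSet G (supportOf s)
  feasible⇒zeroForcing {x = x} F = ranked⇒zeroForcing x (feasible⇒forcer F)

  module _ (C : Subset n) where

    ValidForce : Subset n → (Fin n → ℕ) → Fin n → Fin n → Set
    ValidForce S time u v = u ∈ S × time u < time v ×
                            (∀ w → adj G u w ≡ true → w ≢ v → w ∈ S × time w < time v)

    -- A forcing process from C to S, recorded as a partial solution of IM:
    -- forces u v ≡ 1 iff u forced v, and time v is the number of filled vertices when v was forced.
    record Schedule (S : Subset n) : Set where
      field
        time      : Fin n → ℕ
        forces    : Fin n → Fin n → ℕ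
        forces≤1  : ∀ u v → forces u v ≤ 1
        time<∣S∣  : ∀ v → v ∈ S → time v < ∣ S ∣
        in-degree : ∀ v → v ∈ S → indicator C v + inflow forces v ≡ 1
        valid     : ∀ u v → forces u v ≡ 1 → ValidForce S time u v

    schedule-start : Schedule C
    schedule-start = record
      { time      = const 0
      ; forces    = λ _ _ → 0
      ; forces≤1  = λ _ _ → z≤n
      ; time<∣S∣  = λ _ v∈C → ≤-<-trans z≤n (x∈p⇒∣p-x∣<∣p∣ v∈C)
      ; in-degree = λ v v∈C → cong₂ _+_ (indicator-∈ v∈C) (sumFin-zero (λ u → if-eta (adj G u v)))
      ; valid     = λ _ _ ()
      }

    module Force {S u v} (σ : Schedule S) (u∈S : u ∈ S) (v∉S : v ∉ S) (v∉C : v ∉ C)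
                 (u~v : adj G u v ≡ true) (others : ∀ w → adj G u w ≡ true → w ≢ v → w ∈ S) where
      open Schedule σ

      S′ : Subset n
      S′ = S ∪ ⁅ v ⁆

      time′ : Fin n → ℕ
      time′ = updateAt time v (const ∣ S ∣)

      forces′ : Fin n → Fin n → ℕ
      forces′ a = updateAt (forces a) v (const (indicator ⁅ u ⁆ a))

      ∈S⇒∈S′ : ∀ {w} → w ∈ S → w ∈ S′
      ∈S⇒∈S′ = p⊆p∪q ⁅ v ⁆

      ∈S′⇒∈S : ∀ {w} → w ∈ S′ → w ≢ v → w ∈ S
      ∈S′⇒∈S w∈S′ w≢v with x∈p∪q⁻ S ⁅ v ⁆ w∈S′
      ... | inj₁ w∈S   = w∈S
      ... | inj₂ w∈⁅v⁆ = contradiction (x∈⁅y⁆⇒x≡y v w∈⁅v⁆) w≢v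

      ∈S⇒≢v : ∀ {w} → w ∈ S → w ≢ v
      ∈S⇒≢v w∈S refl = v∉S w∈S

      time′-≢ : ∀ {w} → w ≢ v → time′ w ≡ time w
      time′-≢ w≢v = updateAt-minimal _ v time w≢v

      time′-new : time′ v ≡ ∣ S ∣
      time′-new = updateAt-updates v time

      ∣S∣<∣S′∣ : ∣ S ∣ < ∣ S′ ∣
      ∣S∣<∣S′∣ = p⊂q⇒∣p∣<∣q∣ (∈S⇒∈S′ , v , q⊆p∪q S ⁅ v ⁆ (x∈⁅x⁆ v) , v∉S)

      time′<∣S′∣ : ∀ w → w ∈ S′ → time′ w < ∣ S′ ∣
      time′<∣S′∣ w w∈S′ with w ≟ᶠ v
      ... | yes refl = subst (_< ∣ S′ ∣) (sym time′-new) ∣S∣<∣S′∣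
      ... | no  w≢v  = begin-strict
        time′ w ≡⟨ time′-≢ w≢v ⟩
        time w  <⟨ time<∣S∣ w (∈S′⇒∈S w∈S′ w≢v) ⟩
        ∣ S ∣   <⟨ ∣S∣<∣S′∣ ⟩
        ∣ S′ ∣  ∎
        where open ≤-Reasoning

      filled-before-v : ∀ {w} → w ∈ S → time′ w < time′ v
      filled-before-v {w} w∈S = begin-strict
        time′ w ≡⟨ time′-≢ (∈S⇒≢v w∈S) ⟩
        time w  <⟨ time<∣S∣ w w∈S ⟩
        ∣ S ∣   ≡⟨ time′-new ⟨
        time′ v ∎
        where open ≤-Reasoning

      new-force-valid : ValidForce S′ time′ u v
      new-force-valid = ∈S⇒∈S′ u∈S , filled-before-v u∈S ,
        λ w u~w w≢v → let w∈S = others w u~w w≢v in ∈S⇒∈S′ w∈S , filled-before-v w∈S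

      old-force-valid : ∀ {a b} → b ≢ v → ValidForce S time a b → ValidForce S′ time′ a b
      old-force-valid {a} {b} b≢v (a∈S , ta<tb , others-a) = ∈S⇒∈S′ a∈S , retime a∈S ta<tb ,
        λ w a~w w≢b → let w∈S , tw<tb = others-a w a~w w≢b in ∈S⇒∈S′ w∈S , retime w∈S tw<tb
        where
        retime : ∀ {w} → w ∈ S → time w < time b → time′ w < time′ b
        retime w∈S = subst₂ _<_ (sym (time′-≢ (∈S⇒≢v w∈S))) (sym (time′-≢ b≢v))

      forces′-≢ : ∀ a {b} → b ≢ v → forces′ a b ≡ forces a b
      forces′-≢ a b≢v = updateAt-minimal _ v (forces a) b≢v

      forces′-new : ∀ a → forces′ a v ≡ indicator ⁅ u ⁆ a
      forces′-new a = updateAt-updates v (forces a)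

      forces′≤1 : ∀ a b → forces′ a b ≤ 1
      forces′≤1 a b with b ≟ᶠ v
      ... | yes refl = subst (_≤ 1) (sym (forces′-new a)) (indicator≤1 ⁅ u ⁆ a)
      ... | no  b≢v  = subst (_≤ 1) (sym (forces′-≢ a b≢v)) (forces≤1 a b)

      inflow′-new : inflow forces′ v ≡ 1
      inflow′-new = begin
        inflow forces′ v                       ≡⟨ sumFin-single u only-u ⟩
        (if adj G u v then forces′ u v else 0) ≡⟨ cong (if_then forces′ u v else 0) u~v ⟩
        forces′ u v                            ≡⟨ forces′-new u ⟩
        indicator ⁅ u ⁆ u                      ≡⟨ indicator-∈ (x∈⁅x⁆ u) ⟩
        1                                      ∎
        where
        open ≡-Reasoning
        only-u : ∀ a → a ≢ u → (if adj G a v then forces′ a v else 0) ≡ 0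
        only-u a a≢u = trans (if-cong-then (adj G a v)
                                (trans (forces′-new a) (indicator-∉ (a≢u ∘ x∈⁅y⁆⇒x≡y u))))
                             (if-eta (adj G a v))

      in-degree′ : ∀ b → b ∈ S′ → indicator C b + inflow forces′ b ≡ 1
      in-degree′ b b∈S′ with b ≟ᶠ v
      ... | yes refl = cong₂ _+_ (indicator-∉ v∉C) inflow′-new
      ... | no  b≢v  = begin
        indicator C b + inflow forces′ b ≡⟨ cong (indicator C b +_) (sumFin-cong λ a →
                                              if-cong-then (adj G a b) (forces′-≢ a b≢v)) ⟩
        indicator C b + inflow forces b  ≡⟨ in-degree b (∈S′⇒∈S b∈S′ b≢v) ⟩
        1                                ∎
        where open ≡-Reasoning

      valid′ : ∀ a b → forces′ a b ≡ 1 → ValidForce S′ time′ a b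
      valid′ a b a→b with b ≟ᶠ v
      ... | no  b≢v  = old-force-valid b≢v (valid a b (trans (sym (forces′-≢ a b≢v)) a→b))
      ... | yes refl with refl ← x∈⁅y⁆⇒x≡y u (indicator≡1⇒∈ (trans (sym (forces′-new a)) a→b)) =
        new-force-valid

      schedule : Schedule S′
      schedule = record
        { time      = time′
        ; forces    = forces′
        ; forces≤1  = forces′≤1
        ; time<∣S∣  = time′<∣S′∣
        ; in-degree = in-degree′
        ; valid     = valid′
        }

    reach⇒schedule : ∀ {S} → Reach G C S → Schedule S
    reach⇒schedule start = schedule-start
    reach⇒schedule (force u v r u∈S v∉S u~v others) =
      Force.schedule (reach⇒schedule r) u∈S v∉S (v∉S ∘ Reach⇒⊇ r) u~v others

    schedule⇒feasible : ∀ {S} → (∀ v → v ∈ S) → (σ : Schedule S) →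
      Feasible G (n ∸ 1) (indicator C) (Schedule.time σ) (Schedule.forces σ) (n ∸ 1)
    schedule⇒feasible {S} full σ = record
      { s-bin = indicator≤1 C
      ; x-rng = time≤n-1
      ; y-bin = λ u v _ → forces≤1 u v
      ; z-rng = ≤-refl
      ; c-i   = λ v → in-degree v (full v)
      ; c-ii  = λ u v _ → <⇒bigM (forces≤1 u v)
                  (λ u→v → let _ , tu<tv , _ = valid u v u→v in tu<tv) (time≤n-1 u)
      ; c-iii = λ u v w _ u~w w≢v → <⇒bigM (forces≤1 u v)
                  (λ u→v → let _ , _ , others = valid u v u→v; _ , tw<tv = others w u~w w≢v in tw<tv)
                  (time≤n-1 w)
      ; c-iv  = time≤n-1
      }
      where
      open Schedule σ
      time≤n-1 : ∀ v → time v ≤ n ∸ 1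
      time≤n-1 v = begin
        time v ≤⟨ <⇒≤pred (<-≤-trans (time<∣S∣ v (full v)) (∣p∣≤n S)) ⟩
        pred n ≡⟨ pred[m∸n]≡m∸[1+n] n 0 ⟩
        n ∸ 1  ∎
        where open ≤-Reasoning

    zeroForcing⇒feasible : IsZeroForcingSet G C →
                           ∃[ x ] ∃[ y ] Feasible G (n ∸ 1) (indicator C) x y (n ∸ 1)
    zeroForcing⇒feasible (S , r , full) =
      let σ = reach⇒schedule r in Schedule.time σ , Schedule.forces σ , schedule⇒feasible full σ

corollary3p3 : (n : ℕ) (G : Graph n) (s : Fin n → ℕ) (x : Fin n → ℕ)
    (y : Fin n → Fin n → ℕ) (z : ℕ) →
    Optimal G (n ∸ 1) s x y z →
    IsMinimumZeroForcingSet G (supportOf s)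
corollary3p3 n G s x y z (F , optimal) = feasible⇒zeroForcing G F , minimum
  where
  open ≤-Reasoning
  minimum : ∀ C → IsZeroForcingSet G C → ∣ supportOf s ∣ ≤ ∣ C ∣
  minimum C zfs = let x′ , y′ , F′ = zeroForcing⇒feasible G C zfs in begin
    ∣ supportOf s ∣       ≡⟨ ∣supportOf∣≡sumFin s (Feasible.s-bin F) ⟩
    sumFin s              ≤⟨ optimal (indicator C) x′ y′ (n ∸ 1) F′ ⟩
    sumFin (indicator C)  ≡⟨ sumFin-indicator C ⟩
    ∣ C ∣                 ∎
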